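{- Let $p$ be an odd prime and $N$ a positive integer. Then \[ \max_{\alpha,\beta\in\mathscr B(p,N)}\|\beta-\alpha\|=2Np(p-1)^{1/2}. \]
   Context: $\omega=\exp(2\pi i/p)$; $\mathscr B(p,N)=\{\sum_{j=1}^{p-1}a_j\omega^j: a_j\in[-N,N]\cap\mathbb{Z}\}$; for $\gamma\in\mathbb{Q}(\omega)$, $\mathrm{Tr}(\gamma)=\sum_{\sigma\in\mathrm{Gal}(\mathbb{Q}(\omega)/\mathbb{Q})}\sigma(\gamma)$ and $\|\gamma\|=\big(\sum_{j=1}^{p-1}\mathrm{Tr}(\gamma\omega^j)^2\big)^{1/2}$. -}

module Defs where

open import Data.Nat as ℕ using (ℕ; zero; suc; _∸_; _%_; _≟_)
open import Data.Integer as ℤ using (ℤ; +_; _+_; _-_; _*_; -_)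
open import Data.List using (List; foldr; map; upTo)
open import Data.Bool using (if_then_else_)
open import Relation.Nullary.Decidable using (⌊_⌋)

sumℤ : List ℤ → ℤ
sumℤ = foldr _+_ (+ 0)

range1 : ℕ → List ℕ
range1 p = map suc (upTo (p ∸ 1))

-- An element of ℤ[ω] ⊂ ℚ(ω), ω = exp(2πi/p), written as Σ_{m=0}^{p-1} d m ω^m.
-- (Only the values d 0, …, d (p-1) matter; this is ℤ[x]/(x^p - 1), and
-- ℤ[ω] is its quotient by 1 + x + … + x^{p-1}.)
Elt : Set
Elt = ℕ → ℤ

-- Multiplication by ω^k (0 ≤ k < p): cyclic shift of exponents mod p.
mulω : (p : ℕ) .{{_ : ℕ.NonZero p}} → ℕ → Elt → Elt
mulω p k γ m = γ ((m ℕ.+ (p ∸ k)) % p)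

-- The Galois automorphism σ_a : ω ↦ ω^a, i.e. Σ d n ω^n ↦ Σ d n ω^{a n mod p}.
σ : (p : ℕ) .{{_ : ℕ.NonZero p}} → ℕ → Elt → Elt
σ p a γ m = sumℤ (map (λ n → if ⌊ ((a ℕ.* n) % p) ≟ m ⌋ then γ n else + 0) (upTo p))

-- Tr(γ) = Σ_{a=1}^{p-1} σ_a(γ), computed in ℤ[x]/(x^p-1); the result t is rational,
-- i.e. of the form t0 + c(x + … + x^{p-1}), which equals the integer t0 - c in ℤ[ω].
Tr : (p : ℕ) .{{_ : ℕ.NonZero p}} → Elt → ℤ
Tr p γ = t 0 - t 1
  where
  t : ℕ → ℤ
  t m = sumℤ (map (λ a → σ p a γ m) (range1 p))

normSq : (p : ℕ) .{{_ : ℕ.NonZero p}} → Elt → ℤ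
normSq p γ = sumℤ (map (λ j → Tr p (mulω p j γ) * Tr p (mulω p j γ)) (range1 p))

-- The element Σ_{j=1}^{p-1} a j ω^j from a coefficient function a (values at 1..p-1 used).
elt : (p : ℕ) → (ℕ → ℤ) → Elt
elt p a zero = + 0
elt p a (suc m) = a (suc m)

InB : (p N : ℕ) → (ℕ → ℤ) → Set
InB p N a = ∀ j → 1 ℕ.≤ j → j ℕ.< p → (- (+ N) ℤ.≤ a j) Data.Product.× (a j ℤ.≤ + N)
  where import Data.Product

{-# OPTIONS --safe #-}
module Submission where

-- Write δ ∈ ℤ[x]/(xᵖ - 1) as Σₙ dₙ xⁿ.  For a unit a the map n ↦ a n permutes the
-- nonzero residues mod p and fixes 0, so Σₐ σₐ(δ) has coefficient (p - 1) d₀ at 1 and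
-- Σ_{n ≠ 0} dₙ at x, whence Tr δ = p d₀ - Σₙ dₙ.  Multiplication by ωʲ rotates the
-- coefficients, so for γ = β - α = Σ_{i=1}^{p-1} xᵢ ωⁱ and S = Σ xᵢ we get
-- Tr(γ ωʲ) = p x_{p-j} - S and ‖γ‖² = p² Σ xᵢ² - (p + 1) S².  As |xᵢ| ≤ 2N this is at
-- most 4N²p²(p - 1), with equality when the xᵢ = ±2N alternate in sign: S = 0 since
-- p - 1 is even.

open import Defs
open import Data.Nat as ℕ using (ℕ; zero; suc; _∸_; _%_; _/_; _≤_; NonZero; z≤n; s≤s)
import Data.Nat.Properties as ℕP
open import Data.Nat.Base using (nonTrivial⇒n>1)
open import Data.Nat.DivMod
  using (%-distribˡ-+; %-distribˡ-*; m%n%n≡m%n; [m+n]%n≡m%n; [m+kn]%n≡m%n; m<n⇒m%n≡m; m%n<n; m≡m%n+[m/n]*n)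
open import Data.Nat.Divisibility using (_∣_; _∤_; divides; n∣m⇒m%n≡0; >⇒∤)
open import Data.Nat.Primality using (Prime; euclidsLemma; prime⇒nonTrivial; ¬prime[0])
open import Data.Nat.Coprimality using (prime⇒coprime; coprime-Bézout)
open import Data.Nat.GCD using (module Bézout)
import Data.Nat.Tactic.RingSolver as ℕSolver
open import Data.Integer as ℤ using (ℤ; +_; -[1+_]; _+_; _-_; _*_; -_; ∣_∣; +≤+; -≤-)
import Data.Integer.Properties as ℤP
open import Data.Integer.Tactic.RingSolver using (solve-∀)
open import Data.Fin as Fin using (Fin; toℕ; fromℕ<; opposite; punchIn)
open import Data.Fin.Properties using (toℕ<n; toℕ-fromℕ<; toℕ-injective; punchInᵢ≢i; opposite-prop)
open import Data.Fin.Permutation using (Permutation′; permutation; reverse)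
open import Data.List using (map; applyUpTo; upTo)
open import Data.List.Properties using (map-upTo)
open import Algebra.Properties.CommutativeMonoid.Sum ℤP.+-0-commutativeMonoid
  using (sum; sum-syntax; sum-cong-≗; sum-replicate-zero; sum-remove; ∑-comm; sum-permute)
open import Data.Bool using (if_then_else_)
open import Data.Product using (_×_; _,_; ∃-syntax; uncurry)
open import Data.Sum using (_⊎_; inj₁; inj₂; [_,_]′)
open import Function using (_∘_; id)
open import Relation.Binary.PropositionalEquality
open import Relation.Nullary using (¬_; contradiction)
open import Relation.Nullary.Decidable using (⌊_⌋; yes; no)

sumℤ-applyUpTo : ∀ (f : ℕ → ℤ) g n → sumℤ (map f (applyUpTo g n)) ≡ ∑[ i < n ] f (g (toℕ i))
sumℤ-applyUpTo f g zero    = refl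
sumℤ-applyUpTo f g (suc n) = cong (_+_ (f (g 0))) (sumℤ-applyUpTo f (g ∘ suc) n)

sumℤ-upTo : ∀ (f : ℕ → ℤ) n → sumℤ (map f (upTo n)) ≡ ∑[ i < n ] f (toℕ i)
sumℤ-upTo f = sumℤ-applyUpTo f id

sumℤ-range1 : ∀ (f : ℕ → ℤ) q → sumℤ (map f (range1 (suc q))) ≡ ∑[ i < q ] f (suc (toℕ i))
sumℤ-range1 f q = trans (cong (sumℤ ∘ map f) (map-upTo suc q)) (sumℤ-applyUpTo f suc q)

∑-const : ∀ n c → ∑[ i < n ] c ≡ + n * c
∑-const zero    c = sym (ℤP.*-zeroˡ c)
∑-const (suc n) c = trans (cong (_+_ c) (∑-const n c)) (sym (ℤP.suc-* (+ n) c))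

∑-mono-≤ : ∀ {n} {f g : Fin n → ℤ} → (∀ i → f i ℤ.≤ g i) → sum f ℤ.≤ sum g
∑-mono-≤ {zero}  f≤g = ℤP.≤-refl
∑-mono-≤ {suc n} f≤g = ℤP.+-mono-≤ (f≤g Fin.zero) (∑-mono-≤ (f≤g ∘ Fin.suc))

sum-zero : ∀ {n} {f : Fin n → ℤ} → (∀ i → f i ≡ + 0) → sum f ≡ + 0
sum-zero {n} f≡0 = trans (sum-cong-≗ f≡0) (sum-replicate-zero n)

sum-single : ∀ {n} (f : Fin n → ℤ) i → (∀ j → j ≢ i → f j ≡ + 0) → sum f ≡ f i
sum-single {suc n} f i f≡0 = begin
  sum f                                ≡⟨ sum-remove f ⟩
  f i + ∑[ j < n ] f (punchIn i j)     ≡⟨ cong (_+_ (f i)) (sum-zero (λ j → f≡0 _ (punchInᵢ≢i i j))) ⟩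
  f i + + 0                            ≡⟨ ℤP.+-identityʳ (f i) ⟩
  f i                                  ∎
  where open ≡-Reasoning

∑-[a*x-s]² : ∀ {n} a s (x : Fin n → ℤ) →
  ∑[ i < n ] ((a * x i - s) * (a * x i - s))
    ≡ a * a * ∑[ i < n ] (x i * x i) - (a + a) * s * sum x + + n * (s * s)
∑-[a*x-s]² {zero}  a s x = empty a s
  where
  empty : ∀ a s → + 0 ≡ a * a * + 0 - (a + a) * s * + 0 + + 0 * (s * s)
  empty = solve-∀
∑-[a*x-s]² {suc n} a s x =
  trans (cong (_+_ ((a * x₀ - s) * (a * x₀ - s))) (∑-[a*x-s]² a s (x ∘ Fin.suc))) (cons a s x₀ _ _ (+ n))
  where
  x₀ = x Fin.zero
  cons : ∀ a s x₀ Q S n →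
    (a * x₀ - s) * (a * x₀ - s) + (a * a * Q - (a + a) * s * S + n * (s * s))
      ≡ a * a * (x₀ * x₀ + Q) - (a + a) * s * (x₀ + S) + (+ 1 + n) * (s * s)
  cons = solve-∀

[m%d+n]%d≡[m+n]%d : ∀ m n d .{{_ : NonZero d}} → (m % d ℕ.+ n) % d ≡ (m ℕ.+ n) % d
[m%d+n]%d≡[m+n]%d m n d = begin
  (m % d ℕ.+ n) % d          ≡⟨ %-distribˡ-+ (m % d) n d ⟩
  (m % d % d ℕ.+ n % d) % d  ≡⟨ cong (λ r → (r ℕ.+ n % d) % d) (m%n%n≡m%n m d) ⟩
  (m % d ℕ.+ n % d) % d      ≡⟨ %-distribˡ-+ m n d ⟨
  (m ℕ.+ n) % d              ∎
  where open ≡-Reasoning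

[m%d*n]%d≡[m*n]%d : ∀ m n d .{{_ : NonZero d}} → (m % d ℕ.* n) % d ≡ (m ℕ.* n) % d
[m%d*n]%d≡[m*n]%d m n d = begin
  (m % d ℕ.* n) % d              ≡⟨ %-distribˡ-* (m % d) n d ⟩
  (m % d % d ℕ.* (n % d)) % d    ≡⟨ cong (λ r → (r ℕ.* (n % d)) % d) (m%n%n≡m%n m d) ⟩
  (m % d ℕ.* (n % d)) % d        ≡⟨ %-distribˡ-* m n d ⟨
  (m ℕ.* n) % d                  ∎
  where open ≡-Reasoning

m%d≡n%d⇒d∣n∸m : ∀ m n d .{{_ : NonZero d}} → m % d ≡ n % d → d ∣ n ∸ m
m%d≡n%d⇒d∣n∸m m n d m≡n = divides (n / d ∸ m / d) (begin
  n ∸ m                                              ≡⟨ cong₂ _∸_ (m≡m%n+[m/n]*n n d) (m≡m%n+[m/n]*n m d) ⟩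
  (n % d ℕ.+ n / d ℕ.* d) ∸ (m % d ℕ.+ m / d ℕ.* d)  ≡⟨ cong (λ r → _ ∸ (r ℕ.+ m / d ℕ.* d)) m≡n ⟩
  (n % d ℕ.+ n / d ℕ.* d) ∸ (n % d ℕ.+ m / d ℕ.* d)  ≡⟨ ℕP.[m+n]∸[m+o]≡n∸o (n % d) _ _ ⟩
  n / d ℕ.* d ∸ m / d ℕ.* d                          ≡⟨ ℕP.*-distribʳ-∸ d (n / d) (m / d) ⟨
  (n / d ∸ m / d) ℕ.* d                              ∎)
  where open ≡-Reasoning

module _ {d} .{{_ : NonZero d}} where

  rotate : ℕ → Fin d → Fin d
  rotate r i = fromℕ< (m%n<n (toℕ i ℕ.+ r) d)

  rotate-inverse : ∀ {r s} → r ℕ.+ s ≡ d → ∀ i → rotate s (rotate r i) ≡ i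
  rotate-inverse {r} {s} r+s≡d i = toℕ-injective (begin
    toℕ (rotate s (rotate r i))      ≡⟨ toℕ-fromℕ< _ ⟩
    (toℕ (rotate r i) ℕ.+ s) % d     ≡⟨ cong (λ k → (k ℕ.+ s) % d) (toℕ-fromℕ< _) ⟩
    ((toℕ i ℕ.+ r) % d ℕ.+ s) % d    ≡⟨ [m%d+n]%d≡[m+n]%d (toℕ i ℕ.+ r) s d ⟩
    (toℕ i ℕ.+ r ℕ.+ s) % d          ≡⟨ cong (_% d) (trans (ℕP.+-assoc (toℕ i) r s) (cong (toℕ i ℕ.+_) r+s≡d)) ⟩
    (toℕ i ℕ.+ d) % d                ≡⟨ [m+n]%n≡m%n (toℕ i) d ⟩
    toℕ i % d                        ≡⟨ m<n⇒m%n≡m (toℕ<n i) ⟩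
    toℕ i                            ∎)
    where open ≡-Reasoning

  rotation : ∀ r → r ≤ d → Permutation′ d
  rotation r r≤d = permutation (rotate r) (rotate (d ∸ r))
    (rotate-inverse (ℕP.m∸n+n≡m r≤d)) (rotate-inverse (ℕP.m+[n∸m]≡n r≤d))

  ∑-rotate : ∀ (f : ℕ → ℤ) r → r ≤ d → ∑[ i < d ] f ((toℕ i ℕ.+ r) % d) ≡ ∑[ i < d ] f (toℕ i)
  ∑-rotate f r r≤d = sym (trans (sum-permute (f ∘ toℕ) (rotation r r≤d))
                                (sum-cong-≗ {d} (λ i → cong f (toℕ-fromℕ< _))))

module _ {p} .{{_ : NonZero p}} (p-prime : Prime p) where

  *-cancelʳ-≡-mod : ∀ {a b n} → p ∤ n → a ℕ.< p → b ℕ.< p → (a ℕ.* n) % p ≡ (b ℕ.* n) % p → a ≡ b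
  *-cancelʳ-≡-mod {a} {b} {n} p∤n a<p b<p an≡bn =
    [ (λ a≤b → cancel a≤b b<p an≡bn) , (λ b≤a → sym (cancel b≤a a<p (sym an≡bn))) ]′ (ℕP.≤-total a b)
    where
    cancel : ∀ {a b} → a ≤ b → b ℕ.< p → (a ℕ.* n) % p ≡ (b ℕ.* n) % p → a ≡ b
    cancel {a} {b} a≤b b<p an≡bn with euclidsLemma (b ∸ a) n p-prime
      (subst (p ∣_) (sym (ℕP.*-distribʳ-∸ n b a)) (m%d≡n%d⇒d∣n∸m (a ℕ.* n) (b ℕ.* n) p an≡bn))
    ... | inj₂ p∣n   = contradiction p∣n p∤n
    ... | inj₁ p∣b∸a = ℕP.≤-antisym a≤b (ℕP.m∸n≡0⇒m≤n b∸a≡0)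
      where
      b∸a≡0 : b ∸ a ≡ 0
      b∸a≡0 = trans (sym (m<n⇒m%n≡m (ℕP.≤-<-trans (ℕP.m∸n≤m b a) b<p))) (n∣m⇒m%n≡0 (b ∸ a) p p∣b∸a)

  ∃-inverse-mod : ∀ {n} .{{_ : NonZero n}} → n ℕ.< p → ∃[ a ] (a ℕ.< p × (a ℕ.* n) % p ≡ 1)
  ∃-inverse-mod {n} n<p with inverse (coprime-Bézout (prime⇒coprime p-prime n<p))
    where
    1%p≡1 : 1 % p ≡ 1
    1%p≡1 = m<n⇒m%n≡m (nonTrivial⇒n>1 p {{prime⇒nonTrivial p-prime}})

    inverse : Bézout.Identity 1 p n → ∃[ a ] ((a ℕ.* n) % p ≡ 1)
    inverse (Bézout.-+ x y 1+xp≡yn) = y , (begin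
      (y ℕ.* n) % p         ≡⟨ cong (_% p) 1+xp≡yn ⟨
      (1 ℕ.+ x ℕ.* p) % p   ≡⟨ [m+kn]%n≡m%n 1 x p ⟩
      1 % p                 ≡⟨ 1%p≡1 ⟩
      1                     ∎)
      where open ≡-Reasoning
    -- here y n ≡ -1, so (p - 1) y is an inverse of n
    inverse (Bézout.+- x y 1+yn≡xp) = p′ ℕ.* y , (begin
      (p′ ℕ.* y ℕ.* n) % p                ≡⟨ [m+n]%n≡m%n _ p ⟨
      (p′ ℕ.* y ℕ.* n ℕ.+ p) % p          ≡⟨ cong (λ k → (p′ ℕ.* y ℕ.* n ℕ.+ k) % p) (ℕP.suc-pred p) ⟨
      (p′ ℕ.* y ℕ.* n ℕ.+ suc p′) % p     ≡⟨ cong (_% p) (regroup p′ y n) ⟩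
      (1 ℕ.+ p′ ℕ.* (1 ℕ.+ y ℕ.* n)) % p  ≡⟨ cong (λ k → (1 ℕ.+ p′ ℕ.* k) % p) 1+yn≡xp ⟩
      (1 ℕ.+ p′ ℕ.* (x ℕ.* p)) % p        ≡⟨ cong (λ k → (1 ℕ.+ k) % p) (ℕP.*-assoc p′ x p) ⟨
      (1 ℕ.+ p′ ℕ.* x ℕ.* p) % p          ≡⟨ [m+kn]%n≡m%n 1 (p′ ℕ.* x) p ⟩
      1 % p                               ≡⟨ 1%p≡1 ⟩
      1                                   ∎)
      where
      open ≡-Reasoning
      p′ = ℕ.pred p
      regroup : ∀ a y n → a ℕ.* y ℕ.* n ℕ.+ suc a ≡ 1 ℕ.+ a ℕ.* (1 ℕ.+ y ℕ.* n)
      regroup = ℕSolver.solve-∀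
  ... | a , an≡1 = a % p , m%n<n a p , trans ([m%d*n]%d≡[m*n]%d a n p) an≡1

∣i∣≤n : ∀ {i n} → - + n ℤ.≤ i → i ℤ.≤ + n → ∣ i ∣ ≤ n
∣i∣≤n {+ _}               _         (+≤+ m≤n) = m≤n
∣i∣≤n { -[1+ _ ]} {suc _} (-≤- n≤m) _         = s≤s n≤m

i*i≡+∣i∣*∣i∣ : ∀ i → i * i ≡ + (∣ i ∣ ℕ.* ∣ i ∣)
i*i≡+∣i∣*∣i∣ (+ n)    = sym (ℤP.pos-* n n)
i*i≡+∣i∣*∣i∣ -[1+ n ] = refl

i*i≤n*n : ∀ i {n} → ∣ i ∣ ≤ n → i * i ℤ.≤ + n * + n
i*i≤n*n i {n} ∣i∣≤n = subst₂ ℤ._≤_ (sym (i*i≡+∣i∣*∣i∣ i)) (ℤP.pos-* n n) (+≤+ (ℕP.*-mono-≤ ∣i∣≤n ∣i∣≤n))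

2∣n⊎2∣1+n : ∀ n → (2 ∣ n) ⊎ (2 ∣ suc n)
2∣n⊎2∣1+n zero    = inj₁ (divides 0 refl)
2∣n⊎2∣1+n (suc n) with 2∣n⊎2∣1+n n
... | inj₁ (divides k n≡k*2) = inj₂ (divides (suc k) (cong (suc ∘ suc) n≡k*2))
... | inj₂ 2∣1+n             = inj₁ 2∣1+n

alternating : ℕ → ℕ → ℤ
alternating N zero          = + N
alternating N (suc zero)    = - + N
alternating N (suc (suc j)) = alternating N j

alternating∈[-N,N] : ∀ N j → - + N ℤ.≤ alternating N j × alternating N j ℤ.≤ + N
alternating∈[-N,N] N zero          = ℤP.neg-≤-pos , ℤP.≤-refl
alternating∈[-N,N] N (suc zero)    = ℤP.≤-refl , ℤP.neg-≤-pos
alternating∈[-N,N] N (suc (suc j)) = alternating∈[-N,N] N j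

gap : ℕ → ℕ → ℤ
gap N j = alternating N j - alternating N (suc j)

gap*gap : ∀ N j → gap N j * gap N j ≡ + (N ℕ.+ N) * + (N ℕ.+ N)
gap*gap N zero          = up (+ N)
  where
  up : ∀ n → (n - - n) * (n - - n) ≡ (n + n) * (n + n)
  up = solve-∀
gap*gap N (suc zero)    = down (+ N)
  where
  down : ∀ n → (- n - n) * (- n - n) ≡ (n + n) * (n + n)
  down = solve-∀
gap*gap N (suc (suc j)) = gap*gap N j

∑-gap : ∀ N k → ∑[ i < k ℕ.* 2 ] gap N (toℕ i) ≡ + 0
∑-gap N zero    = refl
∑-gap N (suc k) = trans (cong (λ s → gap N 0 + (gap N 1 + s)) (∑-gap N k)) (cancel (+ N))
  where
  cancel : ∀ n → (n - - n) + ((- n - n) + + 0) ≡ + 0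
  cancel = solve-∀

module Cyclotomic (q : ℕ) (p-prime : Prime (suc q)) where

  p : ℕ
  p = suc q

  σ-term : ℕ → ℕ → ℕ → ℤ → ℤ
  σ-term m a n c = if ⌊ (a ℕ.* n) % p ℕ.≟ m ⌋ then c else + 0

  σ-term-≡ : ∀ {m} a n c → (a ℕ.* n) % p ≡ m → σ-term m a n c ≡ c
  σ-term-≡ {m} a n c an≡m with (a ℕ.* n) % p ℕ.≟ m
  ... | yes _   = refl
  ... | no an≢m = contradiction an≡m an≢m

  σ-term-≢ : ∀ {m} a n c → (a ℕ.* n) % p ≢ m → σ-term m a n c ≡ + 0
  σ-term-≢ {m} a n c an≢m with (a ℕ.* n) % p ℕ.≟ m
  ... | yes an≡m = contradiction an≡m an≢m
  ... | no _     = refl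

  unit : Fin q → ℕ
  unit u = suc (toℕ u)

  unit<p : ∀ u → unit u ℕ.< p
  unit<p u = s≤s (toℕ<n u)

  unit*unit≢0 : ∀ u v → (unit u ℕ.* unit v) % p ≢ 0
  unit*unit≢0 u v uv≡0 with () ← *-cancelʳ-≡-mod p-prime (>⇒∤ (unit<p v)) (unit<p u) (s≤s z≤n) uv≡0

  unit-inverse : ∀ v → ∃[ k ] ((unit k ℕ.* unit v) % p ≡ 1 × (∀ u → (unit u ℕ.* unit v) % p ≡ 1 → u ≡ k))
  unit-inverse v with ∃-inverse-mod p-prime (unit<p v)
  ... | zero  , _   , ()
  ... | suc a , a<p , av≡1 = k , kv≡1 , unique
    where
    k : Fin q
    k = fromℕ< (ℕ.s<s⁻¹ a<p)
    kv≡1 : (unit k ℕ.* unit v) % p ≡ 1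
    kv≡1 = trans (cong (λ b → (suc b ℕ.* unit v) % p) (toℕ-fromℕ< (ℕ.s<s⁻¹ a<p))) av≡1
    unique : ∀ u → (unit u ℕ.* unit v) % p ≡ 1 → u ≡ k
    unique u uv≡1 = toℕ-injective (ℕP.suc-injective
      (*-cancelʳ-≡-mod p-prime (>⇒∤ (unit<p v)) (unit<p u) (unit<p k) (trans uv≡1 (sym kv≡1))))

  trace-coefficient : Elt → ℕ → ℤ
  trace-coefficient δ m = sumℤ (map (λ a → σ p a δ m) (range1 p))

  trace-coefficient-∑ : ∀ δ m →
    trace-coefficient δ m ≡ ∑[ n < p ] ∑[ u < q ] σ-term m (unit u) (toℕ n) (δ (toℕ n))
  trace-coefficient-∑ δ m = begin
    trace-coefficient δ m                                        ≡⟨ sumℤ-range1 (λ a → σ p a δ m) q ⟩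
    ∑[ u < q ] σ p (unit u) δ m                                  ≡⟨ sum-cong-≗ {q} (λ u → sumℤ-upTo (F u) p) ⟩
    ∑[ u < q ] ∑[ n < p ] σ-term m (unit u) (toℕ n) (δ (toℕ n))  ≡⟨ ∑-comm {q} {p} (λ u n → F u (toℕ n)) ⟩
    ∑[ n < p ] ∑[ u < q ] σ-term m (unit u) (toℕ n) (δ (toℕ n))  ∎
    where
    open ≡-Reasoning
    F : Fin q → ℕ → ℤ
    F u n = σ-term m (unit u) n (δ n)

  unit*0≡0 : ∀ u → (unit u ℕ.* 0) % p ≡ 0
  unit*0≡0 u = cong (_% p) (ℕP.*-zeroʳ (unit u))

  trace-coefficient-0 : ∀ δ → trace-coefficient δ 0 ≡ + q * δ 0
  trace-coefficient-0 δ = begin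
    trace-coefficient δ 0  ≡⟨ trace-coefficient-∑ δ 0 ⟩
    ∑[ u < q ] σ-term 0 (unit u) 0 (δ 0) + ∑[ n < q ] ∑[ u < q ] σ-term 0 (unit u) (unit n) (δ (unit n))
      ≡⟨ cong₂ _+_ (sum-cong-≗ {q} (λ u → σ-term-≡ (unit u) 0 (δ 0) (unit*0≡0 u)))
                   (sum-zero (λ n → sum-zero (λ u →
                     σ-term-≢ (unit u) (unit n) (δ (unit n)) (unit*unit≢0 u n)))) ⟩
    ∑[ u < q ] δ 0 + + 0   ≡⟨ ℤP.+-identityʳ _ ⟩
    ∑[ u < q ] δ 0         ≡⟨ ∑-const q (δ 0) ⟩
    + q * δ 0              ∎
    where open ≡-Reasoning

  trace-coefficient-1 : ∀ δ → trace-coefficient δ 1 ≡ ∑[ n < q ] δ (unit n)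
  trace-coefficient-1 δ = begin
    trace-coefficient δ 1  ≡⟨ trace-coefficient-∑ δ 1 ⟩
    ∑[ u < q ] σ-term 1 (unit u) 0 (δ 0) + ∑[ n < q ] ∑[ u < q ] σ-term 1 (unit u) (unit n) (δ (unit n))
      ≡⟨ cong₂ _+_ (sum-zero (λ u →
                     σ-term-≢ (unit u) 0 (δ 0) (ℕP.0≢1+n ∘ trans (sym (unit*0≡0 u)))))
                   (sum-cong-≗ {q} (λ n → hit-once n)) ⟩
    + 0 + ∑[ n < q ] δ (unit n)  ≡⟨ ℤP.+-identityˡ _ ⟩
    ∑[ n < q ] δ (unit n)        ∎
    where
    open ≡-Reasoning
    hit-once : ∀ n → ∑[ u < q ] σ-term 1 (unit u) (unit n) (δ (unit n)) ≡ δ (unit n)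
    hit-once n with k , kn≡1 , unique ← unit-inverse n =
      trans (sum-single _ k (λ u u≢k → σ-term-≢ (unit u) (unit n) (δ (unit n)) (u≢k ∘ unique u)))
            (σ-term-≡ (unit k) (unit n) (δ (unit n)) kn≡1)

  Tr-formula : ∀ δ → Tr p δ ≡ + p * δ 0 - ∑[ n < p ] δ (toℕ n)
  Tr-formula δ = begin
    trace-coefficient δ 0 - trace-coefficient δ 1  ≡⟨ cong₂ _-_ (trace-coefficient-0 δ) (trace-coefficient-1 δ) ⟩
    + q * δ 0 - ∑[ n < q ] δ (unit n)              ≡⟨ regroup (+ q) (δ 0) _ ⟩
    + p * δ 0 - (δ 0 + ∑[ n < q ] δ (unit n))      ∎
    where
    open ≡-Reasoning
    regroup : ∀ q d S → q * d - S ≡ (+ 1 + q) * d - (d + S)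
    regroup = solve-∀

  Tr-mulω : ∀ γ k → Tr p (mulω p k γ) ≡ + p * γ ((p ∸ k) % p) - ∑[ n < p ] γ (toℕ n)
  Tr-mulω γ k = trans (Tr-formula (mulω p k γ))
    (cong (λ S → + p * γ ((p ∸ k) % p) - S) (∑-rotate γ (p ∸ k) (ℕP.m∸n≤m p k)))

  coords : Elt → Fin q → ℤ
  coords γ i = γ (unit i)

  normSq-formula : ∀ γ → γ 0 ≡ + 0 →
    normSq p γ ≡ + p * + p * ∑[ i < q ] (coords γ i * coords γ i)
                 - + suc p * (sum (coords γ) * sum (coords γ))
  normSq-formula γ γ₀≡0 = begin
    normSq p γ                                                    ≡⟨ sumℤ-range1 (λ k → T k * T k) q ⟩
    ∑[ j < q ] (T (unit j) * T (unit j))                          ≡⟨ sum-permute (λ j → T (unit j) * T (unit j)) reverse ⟩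
    ∑[ j < q ] (T (unit (opposite j)) * T (unit (opposite j)))    ≡⟨ sum-cong-≗ {q} (λ j → cong (λ t → t * t) (T-opposite j)) ⟩
    ∑[ j < q ] ((+ p * coords γ j - S) * (+ p * coords γ j - S))  ≡⟨ ∑-[a*x-s]² (+ p) S (coords γ) ⟩
    + p * + p * Q - (+ p + + p) * S * S + + q * (S * S)           ≡⟨ collect (+ q) Q S ⟩
    + p * + p * Q - + suc p * (S * S)                             ∎
    where
    open ≡-Reasoning
    T : ℕ → ℤ
    T k = Tr p (mulω p k γ)
    S Q : ℤ
    S = sum (coords γ)
    Q = ∑[ i < q ] (coords γ i * coords γ i)
    -- Tr(γ ωᵏ) reads off the coefficient of ω^{p-k}; reversing the k lines these up with coords γ.
    index : ∀ j → (p ∸ unit (opposite j)) % p ≡ unit j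
    index j = trans (cong (λ i → (q ∸ i) % p) (opposite-prop j))
                    (trans (cong (_% p) (ℕP.m∸[m∸n]≡n (toℕ<n j))) (m<n⇒m%n≡m (unit<p j)))
    T-opposite : ∀ j → T (unit (opposite j)) ≡ + p * coords γ j - S
    T-opposite j = trans (Tr-mulω γ (unit (opposite j)))
      (cong₂ (λ x Σγ → + p * x - Σγ) (cong γ (index j)) (trans (cong (_+ S) γ₀≡0) (ℤP.+-identityˡ S)))
    collect : ∀ q Q S → (+ 1 + q) * (+ 1 + q) * Q - ((+ 1 + q) + (+ 1 + q)) * S * S + q * (S * S)
                      ≡ (+ 1 + q) * (+ 1 + q) * Q - (+ 1 + (+ 1 + q)) * (S * S)
    collect = solve-∀

  maxNormSq : ℕ → ℤ
  maxNormSq M = + p * + p * (+ q * (+ M * + M))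

  maxNormSq[2N]≡4N²p²q : ∀ N → maxNormSq (N ℕ.+ N) ≡ + (4 ℕ.* N ℕ.* N ℕ.* p ℕ.* p ℕ.* q)
  maxNormSq[2N]≡4N²p²q N = begin
    + p * + p * (+ q * (+ M * + M))      ≡⟨ cong₂ _*_ (ℤP.pos-* p p) (cong (_*_ (+ q)) (ℤP.pos-* M M)) ⟨
    + (p ℕ.* p) * (+ q * + (M ℕ.* M))    ≡⟨ cong (_*_ (+ (p ℕ.* p))) (ℤP.pos-* q (M ℕ.* M)) ⟨
    + (p ℕ.* p) * + (q ℕ.* (M ℕ.* M))    ≡⟨ ℤP.pos-* (p ℕ.* p) (q ℕ.* (M ℕ.* M)) ⟨
    + (p ℕ.* p ℕ.* (q ℕ.* (M ℕ.* M)))    ≡⟨ cong +_ (regroup N p q) ⟩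
    + (4 ℕ.* N ℕ.* N ℕ.* p ℕ.* p ℕ.* q)  ∎
    where
    open ≡-Reasoning
    M = N ℕ.+ N
    regroup : ∀ N p q → p ℕ.* p ℕ.* (q ℕ.* ((N ℕ.+ N) ℕ.* (N ℕ.+ N))) ≡ 4 ℕ.* N ℕ.* N ℕ.* p ℕ.* p ℕ.* q
    regroup = ℕSolver.solve-∀

  normSq-≤ : ∀ γ M → γ 0 ≡ + 0 → (∀ i → ∣ coords γ i ∣ ≤ M) → normSq p γ ℤ.≤ maxNormSq M
  normSq-≤ γ M γ₀≡0 ∣γ∣≤M = begin
    normSq p γ                                        ≡⟨ normSq-formula γ γ₀≡0 ⟩
    + p * + p * Q - + suc p * (S * S)                 ≡⟨ cong (λ j → + p * + p * Q - + suc p * j) (i*i≡+∣i∣*∣i∣ S) ⟩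
    + p * + p * Q - + suc p * + (∣ S ∣ ℕ.* ∣ S ∣)     ≡⟨ cong (_-_ (+ p * + p * Q)) (ℤP.pos-* (suc p) (∣ S ∣ ℕ.* ∣ S ∣)) ⟨
    + p * + p * Q - + (suc p ℕ.* (∣ S ∣ ℕ.* ∣ S ∣))   ≤⟨ ℤP.i-j≤i _ _ ⟩
    + p * + p * Q                                     ≤⟨ ℤP.*-monoˡ-≤-nonNeg (+ p * + p) Q≤ ⟩
    + p * + p * (+ q * (+ M * + M))                   ∎
    where
    open ℤP.≤-Reasoning
    S Q : ℤ
    S = sum (coords γ)
    Q = ∑[ i < q ] (coords γ i * coords γ i)
    Q≤ : Q ℤ.≤ + q * (+ M * + M)
    Q≤ = ℤP.≤-trans (∑-mono-≤ (λ i → i*i≤n*n (coords γ i) (∣γ∣≤M i)))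
                    (ℤP.≤-reflexive (∑-const q (+ M * + M)))

  difference : (ℕ → ℤ) → (ℕ → ℤ) → Elt
  difference a b m = elt p b m - elt p a m

  InB⇒∣unit∣≤N : ∀ {N a} → InB p N a → ∀ i → ∣ a (unit i) ∣ ≤ N
  InB⇒∣unit∣≤N a∈B i = uncurry ∣i∣≤n (a∈B (unit i) (s≤s z≤n) (unit<p i))

  InB-normSq-≤ : ∀ N a b → InB p N a → InB p N b →
                 normSq p (difference a b) ℤ.≤ maxNormSq (N ℕ.+ N)
  InB-normSq-≤ N a b a∈B b∈B = normSq-≤ (difference a b) (N ℕ.+ N) refl λ i →
    ℕP.≤-trans (ℤP.∣i-j∣≤∣i∣+∣j∣ (b (unit i)) (a (unit i)))
               (ℕP.+-mono-≤ (InB⇒∣unit∣≤N b∈B i) (InB⇒∣unit∣≤N a∈B i))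

  alternating-normSq : ∀ N → 2 ∣ q →
    normSq p (difference (alternating N) (alternating N ∘ suc)) ≡ maxNormSq (N ℕ.+ N)
  alternating-normSq N (divides k q≡k*2) = begin
    normSq p (difference (alternating N) (alternating N ∘ suc))
      ≡⟨ normSq-formula (difference (alternating N) (alternating N ∘ suc)) refl ⟩
    + p * + p * ∑[ i < q ] (gap N (toℕ i) * gap N (toℕ i)) - + suc p * (S * S)
      ≡⟨ cong₂ (λ Q S → + p * + p * Q - + suc p * (S * S))
               (trans (sum-cong-≗ {q} (gap*gap N ∘ toℕ)) (∑-const q M²)) S≡0 ⟩
    + p * + p * (+ q * M²) - + suc p * (+ 0 * + 0)
      ≡⟨ drop (+ p * + p * (+ q * M²)) (+ suc p) ⟩
    + p * + p * (+ q * M²)  ∎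
    where
    open ≡-Reasoning
    M² S : ℤ
    M² = + (N ℕ.+ N) * + (N ℕ.+ N)
    S = ∑[ i < q ] gap N (toℕ i)
    S≡0 : S ≡ + 0
    S≡0 = subst (λ n → ∑[ i < n ] gap N (toℕ i) ≡ + 0) (sym q≡k*2) (∑-gap N k)
    drop : ∀ A c → A - c * (+ 0 * + 0) ≡ A
    drop = solve-∀

lemma2 : (p N : ℕ) → Prime p → ¬ (2 ∣ p) → 1 ≤ N → .{{_ : NonZero p}} →
    ((a b : ℕ → ℤ) → InB p N a → InB p N b →
      normSq p (λ m → elt p b m - elt p a m) ℤ.≤ + (4 ℕ.* N ℕ.* N ℕ.* p ℕ.* p ℕ.* (p ℕ.∸ 1)))
    × (∃[ a ] ∃[ b ] (InB p N a × InB p N b ×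
      normSq p (λ m → elt p b m - elt p a m) ≡ + (4 ℕ.* N ℕ.* N ℕ.* p ℕ.* p ℕ.* (p ℕ.∸ 1))))
lemma2 zero    N 0-prime = contradiction 0-prime ¬prime[0]
lemma2 (suc q) N p-prime p-odd _ =
  (λ a b a∈B b∈B → ℤP.≤-trans (InB-normSq-≤ N a b a∈B b∈B) (ℤP.≤-reflexive (maxNormSq[2N]≡4N²p²q N))) ,
  (alternating N , alternating N ∘ suc ,
   (λ j _ _ → alternating∈[-N,N] N j) , (λ j _ _ → alternating∈[-N,N] N (suc j)) ,
   trans (alternating-normSq N 2∣q) (maxNormSq[2N]≡4N²p²q N))
  where
  open Cyclotomic q p-prime
  2∣q : 2 ∣ q
  2∣q = [ id , (λ 2∣p → contradiction 2∣p p-odd) ]′ (2∣n⊎2∣1+n q)
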